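{- There is a meager set $M \subseteq (\omega^\omega)^2$ such that for every superperfect tree $T \subseteq \omega^{<\omega}$ there are $f \neq g$ in $[T]$ with $\langle f, g\rangle \in M$.
   Context: A tree $T \subseteq \omega^{<\omega}$ is superperfect if for every $\sigma \in T$ there is $\tau \in T$ with $\tau \supseteq \sigma$ such that $\tau^\frown\langle n\rangle \in T$ for infinitely many $n$; $[T]$ is the set of infinite branches of $T$. -}

module Defs where

open import Data.Nat using (ℕ; zero; suc; _≤_)
open import Data.List using (List; []; _∷_; _++_; _∷ʳ_; length)
open import Data.Product using (Σ; ∃; ∃-syntax; _×_)
open import Relation.Binary.PropositionalEquality using (_≡_; _≢_)
open import Relation.Nullary using (¬_)

_↾_ : (ℕ → ℕ) → ℕ → List ℕ
f ↾ zero = []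
f ↾ suc n = (f ↾ n) ∷ʳ f n

_≺_ : List ℕ → (ℕ → ℕ) → Set
s ≺ f = f ↾ length s ≡ s

_⊑_ : List ℕ → List ℕ → Set
s ⊑ t = ∃[ u ] s ++ u ≡ t

Rel2 : Set₁
Rel2 = (ℕ → ℕ) → (ℕ → ℕ) → Set

NowhereDense : Rel2 → Set
NowhereDense N =
  ∀ (s t : List ℕ) → ∃[ s' ] ∃[ t' ] (s ⊑ s' × t ⊑ t' ×
    (∀ f g → s' ≺ f → t' ≺ g → ¬ N f g))

Meager : Rel2 → Set₁
Meager M = Σ (ℕ → Rel2) λ N →
  (∀ k → NowhereDense (N k)) × (∀ f g → M f g → ∃[ k ] N k f g)

IsTree : (List ℕ → Set) → Set
IsTree T = T [] × (∀ s t → s ⊑ t → T t → T s)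

IsSuperperfect : (List ℕ → Set) → Set
IsSuperperfect T = IsTree T ×
  (∀ σ → T σ → ∃[ τ ] (σ ⊑ τ × T τ ×
      (∀ m → ∃[ n ] (m ≤ n × T (τ ∷ʳ n)))))

Branch : (List ℕ → Set) → (ℕ → ℕ) → Set
Branch T f = ∀ n → T (f ↾ n)

-- The meager set consists of the pairs (f, g) with only finitely many common
-- records, i.e. positions j with f j = g j ≥ f i, g i for all i ≤ j; it is
-- meager because any pair of basic open sets can be shrunk so as to force a
-- common record at a prescribed position.  Inside a superperfect tree two
-- branches are grown in turns: the branch being worked on is extended to a
-- splitting node and leaves it through a successor larger than every value of
-- the other branch.  From that position on it dominates the other branch up to
-- the other's current length, so no position there is a common record; when it
-- outgrows the other branch the roles swap, and the settled region keeps growing.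

module Submission where

open import Defs
open import Data.Nat using (ℕ; zero; suc; _+_; _∸_; _≤_; _<_; _≤′_; ≤′-refl; ≤′-step; z≤n; s≤s; _<?_)
open import Data.Nat.Properties
open import Data.Nat.ListAction using (sum)
open import Data.List using (List; []; _∷_; _++_; _∷ʳ_; length; replicate; [_])
open import Data.List.Properties using (length-++; ++-assoc; ++-identityʳ; length-replicate)
open import Data.Product using (Σ; ∃-syntax; _×_; _,_; proj₁; proj₂; swap)
open import Data.Sum using (inj₁; inj₂)
open import Data.Empty using (⊥-elim)
open import Data.Bool using (Bool; true; false; _xor_)
open import Function using (_∘_; id)
open import Relation.Binary.PropositionalEquality
  using (_≡_; _≢_; refl; sym; trans; cong; cong₂; subst; subst₂)
open import Relation.Nullary using (¬_; yes; no)

-- Total lookup; positions past the end read as 0.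
at : List ℕ → ℕ → ℕ
at []       i       = 0
at (x ∷ xs) zero    = x
at (x ∷ xs) (suc i) = at xs i

length-∷ʳ : ∀ (xs : List ℕ) n → length (xs ∷ʳ n) ≡ suc (length xs)
length-∷ʳ []       n = refl
length-∷ʳ (x ∷ xs) n = cong suc (length-∷ʳ xs n)

length<length-∷ʳ : ∀ s n → length s < length (s ∷ʳ n)
length<length-∷ʳ s n = subst (length s <_) (sym (length-∷ʳ s n)) ≤-refl

at-++ˡ : ∀ xs ys i → i < length xs → at (xs ++ ys) i ≡ at xs i
at-++ˡ (x ∷ xs) ys zero    _       = refl
at-++ˡ (x ∷ xs) ys (suc i) (s≤s p) = at-++ˡ xs ys i p

at-∷ʳ : ∀ xs n → at (xs ∷ʳ n) (length xs) ≡ n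
at-∷ʳ []       n = refl
at-∷ʳ (x ∷ xs) n = at-∷ʳ xs n

at≤sum : ∀ xs i → at xs i ≤ sum xs
at≤sum []       i       = z≤n
at≤sum (x ∷ xs) zero    = m≤m+n x (sum xs)
at≤sum (x ∷ xs) (suc i) = ≤-trans (at≤sum xs i) (m≤n+m (sum xs) x)

at-∷ʳ-≤ : ∀ xs n → (∀ i → at xs i ≤ n) → ∀ i → at (xs ∷ʳ n) i ≤ n
at-∷ʳ-≤ []       n _     zero    = ≤-refl
at-∷ʳ-≤ []       n _     (suc i) = z≤n
at-∷ʳ-≤ (x ∷ xs) n bound zero    = bound zero
at-∷ʳ-≤ (x ∷ xs) n bound (suc i) = at-∷ʳ-≤ xs n (bound ∘ suc) i

⊑-refl : ∀ s → s ⊑ s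
⊑-refl s = [] , ++-identityʳ s

⊑-trans : ∀ {s t u} → s ⊑ t → t ⊑ u → s ⊑ u
⊑-trans {s} (a , refl) (b , refl) = a ++ b , sym (++-assoc s a b)

⊑-++ : ∀ s u → s ⊑ (s ++ u)
⊑-++ s u = u , refl

⊑-∷ʳ : ∀ s n → s ⊑ (s ∷ʳ n)
⊑-∷ʳ s n = ⊑-++ s [ n ]

⊑-length : ∀ {s t} → s ⊑ t → length s ≤ length t
⊑-length {s} (u , refl) = subst (length s ≤_) (sym (length-++ s)) (m≤m+n _ _)

⊑-at : ∀ {s t} → s ⊑ t → ∀ i → i < length s → at t i ≡ at s i
⊑-at {s} (u , refl) = at-++ˡ s u

⊑-∷ʳ-at : ∀ {s n t} → (s ∷ʳ n) ⊑ t → at t (length s) ≡ n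
⊑-∷ʳ-at {s} {n} p =
  trans (⊑-at p (length s) (length<length-∷ʳ s n)) (at-∷ʳ s n)

∷ʳ-⊑⇒< : ∀ {s n t} → (s ∷ʳ n) ⊑ t → length s < length t
∷ʳ-⊑⇒< {s} {n} p = subst (_≤ _) (length-∷ʳ s n) (⊑-length p)

⊑-chain-mono : (s : ℕ → List ℕ) → (∀ m → s m ⊑ s (suc m)) → ∀ {p q} → p ≤ q → s p ⊑ s q
⊑-chain-mono s chain = go ∘ ≤⇒≤′
  where
  go : ∀ {p q} → p ≤′ q → s p ⊑ s q
  go ≤′-refl     = ⊑-refl _
  go (≤′-step p) = ⊑-trans (go p) (chain _)

↾-suc : ∀ h n → h ↾ suc n ≡ h 0 ∷ ((h ∘ suc) ↾ n)
↾-suc h zero    = refl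
↾-suc h (suc n) = cong (_∷ʳ h (suc n)) (↾-suc h n)

at-↾ : ∀ h n i → i < n → at (h ↾ n) i ≡ h i
at-↾ h (suc n) zero    _       = cong (λ l → at l 0) (↾-suc h n)
at-↾ h (suc n) (suc i) (s≤s p) =
  trans (cong (λ l → at l (suc i)) (↾-suc h n)) (at-↾ (h ∘ suc) n i p)

≺⇒at : ∀ {s h} → s ≺ h → ∀ i → i < length s → h i ≡ at s i
≺⇒at {s} {h} e i p = trans (sym (at-↾ h (length s) i p)) (cong (λ l → at l i) e)

at⇒≺ : ∀ s h → (∀ i → i < length s → h i ≡ at s i) → s ≺ h
at⇒≺ []      h _     = refl
at⇒≺ (x ∷ s) h agree =
  trans (↾-suc h (length s))
        (cong₂ _∷_ (agree 0 (s≤s z≤n)) (at⇒≺ s (h ∘ suc) (λ i p → agree (suc i) (s≤s p))))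

↾-mono : ∀ h {n m} → n ≤ m → (h ↾ n) ⊑ (h ↾ m)
↾-mono h = ⊑-chain-mono (h ↾_) (λ m → ⊑-∷ʳ (h ↾ m) (h m))

pad : ℕ → List ℕ → List ℕ
pad n s = s ++ replicate (n ∸ length s) 0

length-pad : ∀ {n} s → length s ≤ n → length (pad n s) ≡ n
length-pad {n} s p =
  trans (length-++ s) (trans (cong (length s +_) (length-replicate (n ∸ length s))) (m+[n∸m]≡n p))

-- Limits of chains of nodes

module Limit (s : ℕ → List ℕ) (chain : ∀ m → s m ⊑ s (suc m))
             (long : ∀ m → m ≤ length (s m)) where

  limit : ℕ → ℕ
  limit i = at (s (suc i)) i

  limit-at : ∀ m i → i < length (s m) → limit i ≡ at (s m) i
  limit-at m i p with ≤-total (suc i) m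
  ... | inj₁ i<m = sym (⊑-at (⊑-chain-mono s chain i<m) i (long (suc i)))
  ... | inj₂ m≤i = ⊑-at (⊑-chain-mono s chain m≤i) i p

  limit-branch : (T : List ℕ → Set) → IsTree T → (∀ m → T (s m)) → Branch T limit
  limit-branch T (_ , closed) s∈T n =
    closed (limit ↾ n) (s n)
      (subst ((limit ↾ n) ⊑_) (at⇒≺ (s n) limit (limit-at n)) (↾-mono limit (long n)))
      (s∈T n)

-- Common records

CommonRecord : (ℕ → ℕ) → (ℕ → ℕ) → ℕ → Set
CommonRecord f g j = ∀ i → i ≤ j → f i ≤ g j × g i ≤ f j

commonRecord-sym : ∀ {f g j} → CommonRecord f g j → CommonRecord g f j
commonRecord-sym r i p = swap (r i p)

commonRecord-cong : ∀ {f g f′ g′ j} → (∀ i → i ≤ j → f i ≡ f′ i) → (∀ i → i ≤ j → g i ≡ g′ i) →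
                    CommonRecord f g j → CommonRecord f′ g′ j
commonRecord-cong {j = j} f≡ g≡ r i p =
  subst₂ _≤_ (f≡ i p) (g≡ j ≤-refl) (proj₁ (r i p)) ,
  subst₂ _≤_ (g≡ i p) (f≡ j ≤-refl) (proj₂ (r i p))

outrun⇒¬commonRecord : ∀ {f g i j} → i ≤ j → g j < f i → ¬ CommonRecord f g j
outrun⇒¬commonRecord i≤j g<f r = <⇒≱ g<f (proj₁ (r _ i≤j))

NoCommonRecordFrom : ℕ → Rel2
NoCommonRecordFrom k f g = ∀ j → k ≤ j → ¬ CommonRecord f g j

NoCommonRecordIn : ℕ → ℕ → Rel2
NoCommonRecordIn k n f g = ∀ j → k ≤ j → j < n → ¬ CommonRecord f g j

noCommonRecordIn-sym : ∀ {k n f g} → NoCommonRecordIn k n f g → NoCommonRecordIn k n g f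
noCommonRecordIn-sym none j k≤j j<n = none j k≤j j<n ∘ commonRecord-sym

noCommonRecordIn-extend : ∀ {k L n f g f′ g′} → NoCommonRecordIn k L f g →
  (∀ i → i < L → f′ i ≡ f i) → (∀ i → i < L → g′ i ≡ g i) →
  (∀ j → L ≤ j → j < n → g′ j < f′ L) → NoCommonRecordIn k n f′ g′
noCommonRecordIn-extend {L = L} none f′≡ g′≡ outrun j k≤j j<n with j <? L
... | yes j<L = none j k≤j j<L ∘ commonRecord-cong (λ i i≤j → f′≡ i (≤-<-trans i≤j j<L))
                                                   (λ i i≤j → g′≡ i (≤-<-trans i≤j j<L))
... | no j≮L = outrun⇒¬commonRecord (≮⇒≥ j≮L) (outrun j (≮⇒≥ j≮L) j<n)

peak : ∀ {τ n j h} → (τ ∷ʳ n) ≺ h → length τ ≡ j → (∀ i → at τ i ≤ n) →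
       h j ≡ n × (∀ i → i ≤ j → h i ≤ n)
peak {τ} {n} {j} {h} τ≺h τ-length τ≤n =
  trans (value j ≤-refl) (subst (λ m → at (τ ∷ʳ n) m ≡ n) τ-length (at-∷ʳ τ n)) ,
  λ i i≤j → subst (_≤ n) (sym (value i i≤j)) (at-∷ʳ-≤ τ n τ≤n i)
  where
  value : ∀ i → i ≤ j → h i ≡ at (τ ∷ʳ n) i
  value i i≤j =
    ≺⇒at τ≺h i (subst (i <_) (sym (trans (length-∷ʳ τ n) (cong suc τ-length))) (s≤s i≤j))

commonRecord-at-peaks : ∀ {σ ρ n j f g} → (σ ∷ʳ n) ≺ f → (ρ ∷ʳ n) ≺ g →
  length σ ≡ j → length ρ ≡ j → (∀ i → at σ i ≤ n) → (∀ i → at ρ i ≤ n) → CommonRecord f g j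
commonRecord-at-peaks {f = f} {g} σ≺f ρ≺g σ-length ρ-length σ≤n ρ≤n i i≤j
  with peak σ≺f σ-length σ≤n | peak ρ≺g ρ-length ρ≤n
... | fj≡n , f≤n | gj≡n , g≤n =
  subst (f i ≤_) (sym gj≡n) (f≤n i i≤j) , subst (g i ≤_) (sym fj≡n) (g≤n i i≤j)

noCommonRecordFrom-nowhereDense : ∀ k → NowhereDense (NoCommonRecordFrom k)
noCommonRecordFrom-nowhereDense k s t =
  σ ∷ʳ n , ρ ∷ʳ n ,
  ⊑-trans (⊑-++ s _) (⊑-∷ʳ σ n) , ⊑-trans (⊑-++ t _) (⊑-∷ʳ ρ n) ,
  λ f g σ≺f ρ≺g none →
    none L k≤L (commonRecord-at-peaks σ≺f ρ≺g (length-pad s s≤L) (length-pad t t≤L)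
                  (λ i → ≤-trans (at≤sum σ i) (m≤m+n _ _)) (λ i → ≤-trans (at≤sum ρ i) (m≤n+m _ _)))
  where
  L : ℕ
  L = k + length s + length t
  k≤L : k ≤ L
  k≤L = ≤-trans (m≤m+n k (length s)) (m≤m+n _ (length t))
  s≤L : length s ≤ L
  s≤L = ≤-trans (m≤n+m (length s) k) (m≤m+n _ (length t))
  t≤L : length t ≤ L
  t≤L = m≤n+m (length t) (k + length s)
  σ ρ : List ℕ
  σ = pad L s
  ρ = pad L t
  n : ℕ
  n = sum σ + sum ρ

FinitelyManyCommonRecords : Rel2
FinitelyManyCommonRecords f g = ∃[ k ] NoCommonRecordFrom k f g

finitelyManyCommonRecords-meager : Meager FinitelyManyCommonRecords
finitelyManyCommonRecords-meager = NoCommonRecordFrom , noCommonRecordFrom-nowhereDense , λ _ _ → id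

-- Two branches through a superperfect tree

Splitting : (List ℕ → Set) → List ℕ → Set
Splitting T τ = ∀ m → ∃[ n ] (m ≤ n × T (τ ∷ʳ n))

_⊑²_ : List ℕ × List ℕ → List ℕ × List ℕ → Set
(s , t) ⊑² (s′ , t′) = s ⊑ s′ × t ⊑ t′

⊑²-trans : ∀ {p q r} → p ⊑² q → q ⊑² r → p ⊑² r
⊑²-trans (a , b) (c , d) = ⊑-trans a c , ⊑-trans b d

record Stage : Set where
  constructor stage
  field
    base    : List ℕ
    top     : ℕ
    partner : List ℕ

  fresh : List ℕ
  fresh = base ∷ʳ top

open Stage

base<fresh : ∀ c → length (base c) < length (fresh c)
base<fresh c = length<length-∷ʳ (base c) (top c)

nodes : Bool → Stage → List ℕ × List ℕ
nodes false c = fresh c , partner c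
nodes true  c = partner c , fresh c

nodes-extend : ∀ o s {c c′} → nodes false c ⊑² nodes s c′ → nodes o c ⊑² nodes (o xor s) c′
nodes-extend false s     e = e
nodes-extend true  false e = swap e
nodes-extend true  true  e = swap e

data Advance (c c′ : Stage) : Set where
  longer   : length (base c) < length (base c′) → Advance c c′
  catch-up : length (base c′) ≡ length (base c) → length (base c) ≡ length (partner c) →
             length (base c′) < length (partner c′) → Advance c c′

advance² : ∀ {c c′ c″} → Advance c c′ → Advance c′ c″ → length (base c) < length (base c″)
advance² (longer p)         (longer q)         = <-trans p q
advance² (longer p)         (catch-up e _ _)   = subst (_ <_) (sym e) p
advance² (catch-up e _ _)   (longer q)         = subst (_< _) e q
advance² (catch-up _ _ lt)  (catch-up _ e′ _)  = ⊥-elim (<-irrefl e′ lt)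

module Construction (T : List ℕ → Set) (superperfect : IsSuperperfect T) where

  splitting-above : ∀ σ → T σ → ∃[ τ ] (σ ⊑ τ × T τ × Splitting T τ)
  splitting-above = proj₂ superperfect

  large-successor : ∀ {τ} → Splitting T τ → (xs : List ℕ) →
                    ∃[ n ] ((∀ i → at xs i < n) × T (τ ∷ʳ n))
  large-successor split xs with split (suc (sum xs))
  ... | n , big , τn∈T = n , (λ i → <-≤-trans (s≤s (at≤sum xs i)) big) , τn∈T

  root-splitting : ∃[ τ ] ([] ⊑ τ × T τ × Splitting T τ)
  root-splitting = splitting-above [] (proj₁ (proj₁ superperfect))

  τ₀ : List ℕ
  τ₀ = proj₁ root-splitting

  τ₀-splitting : Splitting T τ₀
  τ₀-splitting = proj₂ (proj₂ (proj₂ root-splitting))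

  k : ℕ
  k = length τ₀

  -- Positions below length base are settled; at position length base the
  -- fresh node exceeds every value of the partner.
  record Invariant (c : Stage) : Set where
    field
      fresh∈T           : T (fresh c)
      partner∈T         : T (partner c)
      partner-splitting : Splitting T (partner c)
      base≤partner      : length (base c) ≤ length (partner c)
      top-dominates     : ∀ i → at (partner c) i < top c
      separated         : NoCommonRecordIn k (length (base c)) (at (fresh c)) (at (partner c))

  open Invariant

  record Successor (c : Stage) : Set where
    field
      next           : Stage
      next-invariant : Invariant next
      swapped        : Bool
      extends        : nodes false c ⊑² nodes swapped next
      advance        : Advance c next

  extend-fresh : ∀ c → Invariant c → ∀ {σ} → fresh c ⊑ σ → length σ < length (partner c) →
                 ∃[ n ] ((∀ i → at (partner c) i < n) × T (σ ∷ʳ n)) → Successor c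
  extend-fresh c inv {σ} fresh⊑σ σ<partner (n , n-dominates , σn∈T) = record
    { next           = stage σ n (partner c)
    ; next-invariant = record
      { fresh∈T           = σn∈T
      ; partner∈T         = partner∈T inv
      ; partner-splitting = partner-splitting inv
      ; base≤partner      = <⇒≤ σ<partner
      ; top-dominates     = n-dominates
      ; separated         = noCommonRecordIn-extend (separated inv)
                              (λ i i<L → ⊑-at fresh⊑σn i (<-trans i<L (base<fresh c)))
                              (λ _ _ → refl)
                              (λ j _ _ → subst (at (partner c) j <_) (sym (⊑-∷ʳ-at fresh⊑σn))
                                               (top-dominates inv j))
      }
    ; swapped        = false
    ; extends        = fresh⊑σn , ⊑-refl (partner c)
    ; advance        = longer (∷ʳ-⊑⇒< fresh⊑σ)
    }
    where
    fresh⊑σn : fresh c ⊑ (σ ∷ʳ n)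
    fresh⊑σn = ⊑-trans fresh⊑σ (⊑-∷ʳ σ n)

  overtake : ∀ c → Invariant c → ∀ {σ} → fresh c ⊑ σ → T σ → Splitting T σ →
             length (partner c) ≤ length σ →
             ∃[ n ] ((∀ i → at σ i < n) × T (partner c ∷ʳ n)) → Successor c
  overtake c inv {σ} fresh⊑σ σ∈T σ-splitting partner≤σ (n , n-dominates , partner-n∈T) = record
    { next           = stage (partner c) n σ
    ; next-invariant = record
      { fresh∈T           = partner-n∈T
      ; partner∈T         = σ∈T
      ; partner-splitting = σ-splitting
      ; base≤partner      = partner≤σ
      ; top-dominates     = n-dominates
      ; separated         = noCommonRecordIn-sym (noCommonRecordIn-extend (separated inv)
                              (λ i i<L → ⊑-at fresh⊑σ i (<-trans i<L (base<fresh c)))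
                              (λ i i<L → ⊑-at (⊑-∷ʳ (partner c) n) i
                                              (<-≤-trans i<L (base≤partner inv)))
                              (λ j _ j<partner → subst₂ _<_
                                 (sym (⊑-at (⊑-∷ʳ (partner c) n) j j<partner))
                                 (sym (⊑-∷ʳ-at fresh⊑σ))
                                 (top-dominates inv j)))
      }
    ; swapped        = true
    ; extends        = fresh⊑σ , ⊑-∷ʳ (partner c) n
    ; advance        = advance
    }
    where
    advance : Advance c (stage (partner c) n σ)
    advance with m≤n⇒m<n∨m≡n (base≤partner inv)
    ... | inj₁ base<partner = longer base<partner
    ... | inj₂ base≡partner =
      catch-up (sym base≡partner) base≡partner
               (subst (_< length σ) base≡partner (∷ʳ-⊑⇒< fresh⊑σ))

  step : ∀ c → Invariant c → Successor c
  step c inv with splitting-above (fresh c) (fresh∈T inv)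
  ... | σ , fresh⊑σ , σ∈T , σ-splitting with length σ <? length (partner c)
  ...   | yes σ<partner =
    extend-fresh c inv fresh⊑σ σ<partner (large-successor σ-splitting (partner c))
  ...   | no  σ≮partner =
    overtake c inv fresh⊑σ σ∈T σ-splitting (≮⇒≥ σ≮partner) (large-successor (partner-splitting inv) σ)

  record State : Set where
    constructor state
    field
      current     : Stage
      invariant   : Invariant current
      orientation : Bool

  open State

  state-nodes : State → List ℕ × List ℕ
  state-nodes s = nodes (orientation s) (current s)

  next-state : State → State
  next-state (state c inv o) =
    state (Successor.next s) (Successor.next-invariant s) (o xor Successor.swapped s)
    where
    s : Successor c
    s = step c inv

  next-state-extends : ∀ s → state-nodes s ⊑² state-nodes (next-state s)
  next-state-extends (state c inv o) = nodes-extend o (Successor.swapped s) (Successor.extends s)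
    where
    s : Successor c
    s = step c inv

  next-state-advance : ∀ s → Advance (current s) (current (next-state s))
  next-state-advance (state c inv o) = Successor.advance (step c inv)

  initial : ∃[ J ] ∃[ τ ] (Invariant (stage τ₀ J τ) × length τ₀ < length τ)
  initial with τ₀-splitting 0
  ... | _ , _ , τ₀n∈T with splitting-above _ τ₀n∈T
  ... | τ , τ₀n⊑τ , τ∈T , τ-splitting with large-successor τ₀-splitting τ
  ... | J , J-dominates , τ₀J∈T = J , τ , inv , ∷ʳ-⊑⇒< τ₀n⊑τ
    where
    inv : Invariant (stage τ₀ J τ)
    inv = record
      { fresh∈T           = τ₀J∈T
      ; partner∈T         = τ∈T
      ; partner-splitting = τ-splitting
      ; base≤partner      = <⇒≤ (∷ʳ-⊑⇒< τ₀n⊑τ)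
      ; top-dominates     = J-dominates
      ; separated         = λ j k≤j j<k → ⊥-elim (<⇒≱ j<k k≤j)
      }

  J₀ : ℕ
  J₀ = proj₁ initial

  τ₁ : List ℕ
  τ₁ = proj₁ (proj₂ initial)

  initial-invariant : Invariant (stage τ₀ J₀ τ₁)
  initial-invariant = proj₁ (proj₂ (proj₂ initial))

  τ₀<τ₁ : length τ₀ < length τ₁
  τ₀<τ₁ = proj₂ (proj₂ (proj₂ initial))

  record Sound (L : ℕ) (p : List ℕ × List ℕ) : Set where
    field
      left∈T      : T (proj₁ p)
      right∈T     : T (proj₂ p)
      left-long   : L ≤ length (proj₁ p)
      right-long  : L ≤ length (proj₂ p)
      separated   : NoCommonRecordIn k L (at (proj₁ p)) (at (proj₂ p))

  nodes-sound : ∀ {c} → Invariant c → ∀ o → Sound (length (base c)) (nodes o c)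
  nodes-sound {c} inv false = record
    { left∈T     = fresh∈T inv
    ; right∈T    = partner∈T inv
    ; left-long  = <⇒≤ (base<fresh c)
    ; right-long = base≤partner inv
    ; separated  = separated inv
    }
  nodes-sound {c} inv true = record
    { left∈T     = partner∈T inv
    ; right∈T    = fresh∈T inv
    ; left-long  = base≤partner inv
    ; right-long = <⇒≤ (base<fresh c)
    ; separated  = noCommonRecordIn-sym (separated inv)
    }

  -- A single step may leave the length of base unchanged (catch-up), two steps never do.
  run : ℕ → State
  run zero    = state (stage τ₀ J₀ τ₁) initial-invariant false
  run (suc m) = next-state (next-state (run m))

  verified : ℕ → ℕ
  verified m = length (base (current (run m)))

  verified-grows : ∀ m → m ≤ verified m
  verified-grows zero    = z≤n
  verified-grows (suc m) =
    ≤-<-trans (verified-grows m)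
              (advance² (next-state-advance (run m)) (next-state-advance (next-state (run m))))

  run-extends : ∀ m → state-nodes (run m) ⊑² state-nodes (run (suc m))
  run-extends m = ⊑²-trans (next-state-extends (run m)) (next-state-extends (next-state (run m)))

  run-sound : ∀ m → Sound (verified m) (state-nodes (run m))
  run-sound m = nodes-sound (invariant (run m)) (orientation (run m))

  module F = Limit (proj₁ ∘ state-nodes ∘ run) (proj₁ ∘ run-extends)
                   (λ m → ≤-trans (verified-grows m) (Sound.left-long (run-sound m)))
  module G = Limit (proj₂ ∘ state-nodes ∘ run) (proj₂ ∘ run-extends)
                   (λ m → ≤-trans (verified-grows m) (Sound.right-long (run-sound m)))

  f g : ℕ → ℕ
  f = F.limit
  g = G.limit

  f-branch : Branch T f
  f-branch = F.limit-branch T (proj₁ superperfect) (Sound.left∈T ∘ run-sound)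

  g-branch : Branch T g
  g-branch = G.limit-branch T (proj₁ superperfect) (Sound.right∈T ∘ run-sound)

  f≢g : f k ≢ g k
  f≢g f≡g = <⇒≢ g<f (sym f≡g)
    where
    g<f : g k < f k
    g<f = subst₂ _<_
            (sym (G.limit-at 0 k τ₀<τ₁))
            (sym (trans (F.limit-at 0 k (length<length-∷ʳ τ₀ J₀)) (at-∷ʳ τ₀ J₀)))
            (top-dominates initial-invariant k)

  no-common-record : NoCommonRecordFrom k f g
  no-common-record j k≤j =
    Sound.separated sound j k≤j j<verified ∘
      commonRecord-cong (λ i i≤j → F.limit-at (suc j) i (below i≤j (Sound.left-long sound)))
                        (λ i i≤j → G.limit-at (suc j) i (below i≤j (Sound.right-long sound)))
    where
    sound : Sound (verified (suc j)) (state-nodes (run (suc j)))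
    sound = run-sound (suc j)
    j<verified : j < verified (suc j)
    j<verified = verified-grows (suc j)
    below : ∀ {i n} → i ≤ j → verified (suc j) ≤ n → i < n
    below i≤j v≤n = <-≤-trans (≤-<-trans i≤j j<verified) v≤n

proposition5p3 : Σ Rel2 λ M → Meager M ×
    (∀ (T : List ℕ → Set) → IsSuperperfect T →
      ∃[ f ] ∃[ g ] (Branch T f × Branch T g × (∃[ n ] f n ≢ g n) × M f g))
proposition5p3 = FinitelyManyCommonRecords , finitelyManyCommonRecords-meager , λ T superperfect →
  let open Construction T superperfect
  in f , g , f-branch , g-branch , (k , f≢g) , (k , no-common-record)
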